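{- Let $T$ be a directed tree with source (root) $\rho$, let $R$ be a finite set of positive integers such that $T$ can be burned using $R$ (i.e., there is a burning assignment $\phi:R\to V(T)$ with $V(T)=\bigcup_{r\in R}N^+_{r-1}(\phi(r))$), and let $s$ be a sink of $T$ at maximum distance from $\rho$. Then either $d(\rho,s)\leq \max(R)-1$, or there exist a burning assignment $\phi:R\to V(T)$ with $V(T)=\bigcup_{r\in R}N^+_{r-1}(\phi(r))$ and some $r\in R$ such that $\phi(r)=v$, where $v$ is the node with $d(v,s)=r-1$ (the ancestor of $s$ at distance $r-1$).
   Context: A directed tree is a rooted tree with all arcs directed away from the root. $d(u,w)$ is the directed distance from $u$ to $w$. For a node $v$ and $k\ge 0$, the $k$-out-neighbourhood $N^+_k(v)$ is the set of nodes reachable from $v$ using at most $k$ arcs (so $N^+_0(v)=\{v\}$). For a set $R$ of positive integers ("burning ranges"), a burning assignment is any map $\phi:R\to V(T)$ (not necessarily injective). -}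

module Defs where

open import Data.Nat using (ℕ; zero; suc; _≤_; _⊔_; _∸_)
open import Data.Fin using (Fin)
open import Data.Maybe using (Maybe; just; nothing)
open import Data.List using (List; foldr)
open import Data.List.Membership.Propositional using (_∈_)
open import Data.Product using (Σ; ∃; _×_; ∃-syntax)
open import Relation.Binary.PropositionalEquality using (_≡_)

-- A finite directed tree (arborescence) on vertex set Fin n:
-- every vertex except the root has a unique parent (its unique in-neighbour);
-- arcs are  parent w ↦ w  (directed away from the root);
-- every vertex is reachable from the root by a directed path.

data DPath {n : ℕ} (parent : Fin n → Maybe (Fin n)) (u : Fin n) : Fin n → ℕ → Set where
  here : DPath parent u u zero
  step : ∀ {w x k} → DPath parent u w k → parent x ≡ just w → DPath parent u x (suc k)

record DTree (n : ℕ) : Set where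
  field
    parent    : Fin n → Maybe (Fin n)
    root      : Fin n
    root-src  : parent root ≡ nothing
    nonroot   : ∀ v → parent v ≡ nothing → v ≡ root
    reachable : ∀ v → ∃[ k ] DPath parent root v k

module _ {n : ℕ} (T : DTree n) where
  open DTree T

  Dist : Fin n → Fin n → ℕ → Set
  Dist u w k = DPath parent u w k

  Arc : Fin n → Fin n → Set
  Arc u w = parent w ≡ just u

  InNbhd : ℕ → Fin n → Fin n → Set
  InNbhd k v w = ∃[ j ] (j ≤ k × Dist v w j)

  IsSink : Fin n → Set
  IsSink s = ∀ x → Arc s x → Data.Empty.⊥
    where import Data.Empty

  -- φ burns T with ranges R: V(T) = ⋃_{r∈R} N⁺_{r-1}(φ r)
  -- (φ is given on all of ℕ; only its values on R matter)
  Burns : List ℕ → (ℕ → Fin n) → Set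
  Burns R φ = ∀ w → ∃[ r ] (r ∈ R × InNbhd (r ∸ 1) (φ r) w)

maxL : List ℕ → ℕ
maxL = foldr _⊔_ 0

module Submission where

-- Let r be a range whose fire reaches s, from u = φ r within j ≤ r - 1 steps. If the tree is
-- deeper than max R - 1, the ancestor v of s at distance r - 1 exists, and u lies on the path
-- from v to s because parents are unique. Moving the fire of r from u up to v loses nothing:
-- a node w reached from u in i steps has depth  depth v + (r - 1 - j) + i ≤ D = depth v + (r - 1),
-- so w is reached from v in (r - 1 - j) + i ≤ r - 1 steps.

open import Defs
open import Data.Nat using (ℕ; _≤_; _<_; _∸_; zero; suc; _+_; _≟_; s≤s)
open import Data.Nat.Properties
  using (≤-<-connex; ≤-trans; <⇒≤; ∸-monoˡ-≤; m≤m⊔n; m≤n⊔m; +-assoc; +-cancelʳ-≤; m+[n∸m]≡n)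
open import Data.Fin using (Fin)
open import Data.Maybe using (Maybe)
open import Data.Maybe.Properties using (just-injective)
open import Data.List using (List; _∷_)
open import Data.List.Relation.Unary.All using (All)
open import Data.List.Relation.Unary.Any using (here; there)
open import Data.List.Membership.Propositional using (_∈_)
open import Data.Product using (_×_; ∃-syntax; _,_)
open import Data.Sum using (_⊎_; inj₁; inj₂)
open import Relation.Nullary using (yes; no; ¬_; contradiction)
open import Relation.Binary.PropositionalEquality using (_≡_; refl; sym; trans; subst; subst₂)

∈⇒≤maxL : ∀ {r} (R : List ℕ) → r ∈ R → r ≤ maxL R
∈⇒≤maxL (x ∷ R) (here refl) = m≤m⊔n x (maxL R)
∈⇒≤maxL (x ∷ R) (there r∈R) = ≤-trans (∈⇒≤maxL R r∈R) (m≤n⊔m x (maxL R))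

module _ {n : ℕ} {parent : Fin n → Maybe (Fin n)} where

  DPath-++ : ∀ {u v w a b} → DPath parent u v a → DPath parent v w b → DPath parent u w (b + a)
  DPath-++ p here       = p
  DPath-++ p (step q e) = step (DPath-++ p q) e

  DPath-splitAt : ∀ {u w k} m → m ≤ k → DPath parent u w k →
                  ∃[ v ] (DPath parent u v (k ∸ m) × DPath parent v w m)
  DPath-splitAt zero    _       p          = _ , p , here
  DPath-splitAt (suc m) (s≤s m≤k) (step p e) with DPath-splitAt m m≤k p
  ... | v , p₁ , p₂ = v , p₁ , step p₂ e

  DPath-source-unique : ∀ {u v w} k → DPath parent u w k → DPath parent v w k → u ≡ v
  DPath-source-unique zero    here        here          = refl
  DPath-source-unique (suc k) (step p e) (step q e′) with just-injective (trans (sym e) e′)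
  ... | refl = DPath-source-unique k p q

  DPath-through : ∀ {u v w k j} → j ≤ k → DPath parent v w k → DPath parent u w j →
                  DPath parent v u (k ∸ j)
  DPath-through {j = j} j≤k p q with DPath-splitAt j j≤k p
  ... | _ , p₁ , p₂ with DPath-source-unique j p₂ q
  ... | refl = p₁

update : {A : Set} → (ℕ → A) → ℕ → A → ℕ → A
update φ r v x with x ≟ r
... | yes _ = v
... | no  _ = φ x

update-≡ : {A : Set} (φ : ℕ → A) (r : ℕ) (v : A) → update φ r v r ≡ v
update-≡ φ r v with r ≟ r
... | yes _   = refl
... | no  r≢r = contradiction refl r≢r

update-≢ : {A : Set} (φ : ℕ → A) {r x : ℕ} (v : A) → ¬ x ≡ r → update φ r v x ≡ φ x
update-≢ φ {r} {x} v x≢r with x ≟ r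
... | yes x≡r = contradiction x≡r x≢r
... | no  _   = refl

module _ {n : ℕ} (T : DTree n) where
  open DTree T

  Burns-update : ∀ {R φ r v} → Burns T R φ →
                 (∀ w → InNbhd T (r ∸ 1) (φ r) w → InNbhd T (r ∸ 1) v w) →
                 Burns T R (update φ r v)
  Burns-update {φ = φ} {r} {v} burns φr⊆v w with burns w
  ... | r′ , r′∈R , w∈N with r′ ≟ r
  ... | yes refl = r′ , r′∈R , subst (λ x → InNbhd T (r ∸ 1) x w) (sym (update-≡ φ r v)) (φr⊆v w w∈N)
  ... | no  r′≢r = r′ , r′∈R , subst (λ x → InNbhd T (r′ ∸ 1) x w) (sym (update-≢ φ v r′≢r)) w∈N

  InNbhd-lift : ∀ {D a k b v u} → (∀ w i → Dist T root w i → i ≤ D) →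
                Dist T root v a → k + a ≡ D → Dist T v u b →
                ∀ w → InNbhd T k u w → InNbhd T k v w
  InNbhd-lift {D} {a} {k} {b} depth≤D root⇝v k+a≡D v⇝u w (i , _ , u⇝w) =
    i + b , i+b≤k , DPath-++ v⇝u u⇝w
    where
    i+b≤k : i + b ≤ k
    i+b≤k = +-cancelʳ-≤ a (i + b) k
      (subst₂ _≤_ (sym (+-assoc i b a)) (sym k+a≡D)
        (depth≤D w _ (DPath-++ (DPath-++ root⇝v v⇝u) u⇝w)))

  Burns-relocate : ∀ {D R φ r s} → (∀ w i → Dist T root w i → i ≤ D) → Dist T root s D →
                   Burns T R φ → r ∈ R → r ∸ 1 ≤ D → InNbhd T (r ∸ 1) (φ r) s →
                   ∃[ φ′ ] (Burns T R φ′ × ∃[ r ] (r ∈ R × ∃[ v ] (Dist T v s (r ∸ 1) × φ′ r ≡ v)))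
  Burns-relocate {φ = φ} {r} depth≤D root⇝s burns r∈R r-1≤D (j , j≤r-1 , φr⇝s)
    with DPath-splitAt (r ∸ 1) r-1≤D root⇝s
  ... | v , root⇝v , v⇝s =
    update φ r v
    , Burns-update burns
        (InNbhd-lift depth≤D root⇝v (m+[n∸m]≡n r-1≤D) (DPath-through j≤r-1 v⇝s φr⇝s))
    , r , r∈R , v , v⇝s , update-≡ φ r v

mainTheorem9 : ∀ {n} (T : DTree n) (R : List ℕ) → All (λ r → 0 < r) R
    → (∃[ φ ] Burns T R φ)
    → (s : Fin n) (D : ℕ) → IsSink T s → Dist T (DTree.root T) s D
    → (∀ w k → Dist T (DTree.root T) w k → k ≤ D)
    → D ≤ maxL R ∸ 1
    ⊎ ∃[ φ ] (Burns T R φ × ∃[ r ] (r ∈ R × ∃[ v ] (Dist T v s (r ∸ 1) × φ r ≡ v)))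
mainTheorem9 T R _ (φ , burns) s D _ root⇝s depth≤D with ≤-<-connex D (maxL R ∸ 1)
... | inj₁ D≤max = inj₁ D≤max
... | inj₂ max<D with burns s
... | r , r∈R , s∈N = inj₂ (Burns-relocate T depth≤D root⇝s burns r∈R r-1≤D s∈N)
  where
  r-1≤D : r ∸ 1 ≤ D
  r-1≤D = ≤-trans (∸-monoˡ-≤ 1 (∈⇒≤maxL R r∈R)) (<⇒≤ max<D)
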